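{- Let $S$ be a solid and let $x,y\in S$. Then $e(x)e(y)\le e(xy)$.
   Context: A solid is a set $S$ with binary operations $+$ and $\cdot$ and a relation $\le$ satisfying: (1) $+$ is associative and commutative; for every $x$ there is a unique $e$ with $x+e=x$ and $e+f=e$ whenever $x+f=x$, written $e(x)$ (the magnitude of $x$); for every $x$ there is $s$ with $x+s=e(x)$ and $e(s)=e(x)$, written $-x$; $e(x+y)=e(x)$ or $e(x+y)=e(y)$. (2) $\cdot$ is associative and commutative; for every $x\ne e(x)$ there is a unique $u$ with $xu=x$ and $uv=u$ whenever $xv=x$, written $u(x)$; for every $x\ne e(x)$ there is $d$ with $xd=u(x)$ and $u(d)=u(x)$, written $x^{ -1}$; for $x\ne e(x),y\ne e(y)$: $u(xy)=u(x)$ or $u(xy)=u(y)$. (3) $\le$ is a total order; $x\le y\Rightarrow x+z\le y+z$; $y+e(x)=e(x)\Rightarrow (y\le e(x)$ and $-y\le e(x))$; $(e(x)<x$ and $y\le z)\Rightarrow xy\le xz$; $e(y)\le y\le z\Rightarrow e(x)y\le e(x)z$. (4) For all $x,y$ there is $z$ with $e(x)y=e(z)$; $e(xy)=e(x)y+e(y)x$; for $x\ne e(x)$, $e(u(x))=e(x)x^{ -1}$; $xy+xz=x(y+z)+e(x)y+e(x)z$; $-(xy)=(-x)y$. (5) There is $0$ with $0+x=x$ for all $x$; there is $1$ with $1x=x$ for all $x$; there is $M$ with $e(x)+M=M$ for all $x$; there is $x$ with $e(x)\ne 0$ and $e(x)\ne M$; for every $x$ there is $a$ with $x=a+e(x)$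 and $e(a)=0$; if $x=e(x)$, $y=e(y)$ and $x<y$ then there is $z\ne e(z)$ with $x<z<y$. -}

module Defs where

open import Level using (Level; suc)
open import Data.Product using (Σ; ∃; _×_; _,_)
open import Data.Sum using (_⊎_)
open import Relation.Nullary using (¬_)
open import Relation.Binary.PropositionalEquality using (_≡_; _≢_)
open import Relation.Binary.Structures using (IsTotalOrder)

-- The uniquely determined magnitude e(x) and unit u(x), and the chosen
-- negative -x and inverse x⁻¹, are carried as operations together with
-- their defining properties (u and ⁻¹ are only constrained for x ≢ e x).
record Solid (c : Level) : Set (suc c) where
  infixl 6 _+_
  infixl 7 _·_
  infix 4 _≤_ _<_
  field
    Carrier : Set c
    _+_ _·_ : Carrier → Carrier → Carrier
    _≤_     : Carrier → Carrier → Set c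
    e       : Carrier → Carrier
    -_      : Carrier → Carrier
    u       : Carrier → Carrier
    _⁻¹     : Carrier → Carrier

  _<_ : Carrier → Carrier → Set c
  x < y = x ≤ y × x ≢ y

  field
    +-assoc : ∀ x y z → (x + y) + z ≡ x + (y + z)
    +-comm  : ∀ x y → x + y ≡ y + x
    e-neutral : ∀ x → x + e x ≡ x
    e-minimal : ∀ x f → x + f ≡ x → e x + f ≡ e x
    e-unique  : ∀ x e′ → x + e′ ≡ x → (∀ f → x + f ≡ x → e′ + f ≡ e′) → e′ ≡ e x
    neg-inv   : ∀ x → x + (- x) ≡ e x
    neg-e     : ∀ x → e (- x) ≡ e x
    e-+       : ∀ x y → (e (x + y) ≡ e x) ⊎ (e (x + y) ≡ e y)
    ·-assoc : ∀ x y z → (x · y) · z ≡ x · (y · z)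
    ·-comm  : ∀ x y → x · y ≡ y · x
    u-neutral : ∀ x → x ≢ e x → x · u x ≡ x
    u-minimal : ∀ x → x ≢ e x → ∀ v → x · v ≡ x → u x · v ≡ u x
    u-unique  : ∀ x → x ≢ e x → ∀ u′ → x · u′ ≡ x → (∀ v → x · v ≡ x → u′ · v ≡ u′) → u′ ≡ u x
    inv-inv   : ∀ x → x ≢ e x → x · (x ⁻¹) ≡ u x
    inv-u     : ∀ x → x ≢ e x → u (x ⁻¹) ≡ u x
    u-·       : ∀ x y → x ≢ e x → y ≢ e y → (u (x · y) ≡ u x) ⊎ (u (x · y) ≡ u y)
    ≤-isTotalOrder : IsTotalOrder _≡_ _≤_
    ≤-+   : ∀ x y z → x ≤ y → x + z ≤ y + z
    ≤-e   : ∀ x y → y + e x ≡ e x → (y ≤ e x) × (- y ≤ e x)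
    ≤-·   : ∀ x y z → e x < x → y ≤ z → x · y ≤ x · z
    ≤-e·  : ∀ x y z → e y ≤ y → y ≤ z → e x · y ≤ e x · z
    e·-e      : ∀ x y → ∃ λ z → e x · y ≡ e z
    e-·       : ∀ x y → e (x · y) ≡ e x · y + e y · x
    e-u       : ∀ x → x ≢ e x → e (u x) ≡ e x · (x ⁻¹)
    distrib   : ∀ x y z → x · y + x · z ≡ x · (y + z) + e x · y + e x · z
    neg-·     : ∀ x y → - (x · y) ≡ (- x) · y
    0#  : Carrier
    +-identityˡ : ∀ x → 0# + x ≡ x
    1#  : Carrier
    ·-identityˡ : ∀ x → 1# · x ≡ x
    M   : Carrier
    M-absorb : ∀ x → e x + M ≡ M
    nontrivial : ∃ λ x → (e x ≢ 0#) × (e x ≢ M)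
    decompose  : ∀ x → ∃ λ a → (x ≡ a + e x) × (e a ≡ 0#)
    dense      : ∀ x y → x ≡ e x → y ≡ e y → x < y →
                 ∃ λ z → (z ≢ e z) × (x < z) × (z < y)

module Submission where

open import Defs
open import Level using (Level)
open import Data.Product using (_,_; proj₁)
open import Relation.Binary.PropositionalEquality

-- By axiom (4), e(xy) = e(x)y + e(y)x, and e(x)y is itself a magnitude, so
-- e(x)y = e(e(x)y) = e(x)y + e(x)e(y) absorbs e(x)e(y); hence so does e(xy).
-- An element absorbed by a magnitude lies below it by axiom (3).

module _ {c : Level} (S : Solid c) where
  open Solid S

  e-idem : ∀ w → e (e w) ≡ e w
  e-idem w = sym (e-unique (e w) (e w) (e-minimal w (e w) (e-neutral w)) (λ _ p → p))

  e-fixes-magnitude : ∀ w z → w ≡ e z → e w ≡ w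
  e-fixes-magnitude w z w≡ez = begin
    e w     ≡⟨ cong e w≡ez ⟩
    e (e z) ≡⟨ e-idem z ⟩
    e z     ≡⟨ sym w≡ez ⟩
    w       ∎
    where open ≡-Reasoning

  absorbed-by-magnitude⇒≤ : ∀ x y → e x + y ≡ e x → y ≤ e x
  absorbed-by-magnitude⇒≤ x y absorbed = subst (y ≤_) (e-idem x) (proj₁ (≤-e (e x) y y+eex≡eex))
    where
    y+eex≡eex : y + e (e x) ≡ e (e x)
    y+eex≡eex rewrite e-idem x = trans (+-comm y (e x)) absorbed

  e·-absorbs-e·e : ∀ x y → e x · y + e x · e y ≡ e x · y
  e·-absorbs-e·e x y with e·-e x y
  ... | z , ex·y≡ez = begin
    e x · y + e x · e y       ≡⟨ cong₂ _+_ (cong (_· y) (e-idem x)) (·-comm (e y) (e x)) ⟨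
    e (e x) · y + e y · e x   ≡⟨ e-· (e x) y ⟨
    e (e x · y)               ≡⟨ e-fixes-magnitude (e x · y) z ex·y≡ez ⟩
    e x · y                   ∎
    where open ≡-Reasoning

  e-·-absorbs-e·e : ∀ x y → e (x · y) + e x · e y ≡ e (x · y)
  e-·-absorbs-e·e x y = begin
    e (x · y) + exey        ≡⟨ cong (_+ exey) (e-· x y) ⟩
    (a + b) + exey          ≡⟨ +-assoc a b exey ⟩
    a + (b + exey)          ≡⟨ cong (a +_) (+-comm b exey) ⟩
    a + (exey + b)          ≡⟨ +-assoc a exey b ⟨
    (a + exey) + b          ≡⟨ cong (_+ b) (e·-absorbs-e·e x y) ⟩
    a + b                   ≡⟨ e-· x y ⟨
    e (x · y)               ∎
    where
    open ≡-Reasoning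
    a b exey : Carrier
    a = e x · y
    b = e y · x
    exey = e x · e y

proposition2p19 : ∀ {c} (S : Solid c) → let open Solid S in
    ∀ x y → e x · e y ≤ e (x · y)
proposition2p19 S x y =
  absorbed-by-magnitude⇒≤ S (x · y) (e x · e y) (e-·-absorbs-e·e S x y)
  where open Solid S
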